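{- Let $G_0$ be a finite abelian group, let $H\leq G\leq G_0$ be subgroups, let $\alpha\in G_0$, let $A\subseteq\mathbb Z$ be nonempty, and let $S$ be a sequence over $G_0$ with all terms in $\alpha+G$ and $|S|\geq\mathsf D_A(G/H)$. If $A\cdot\alpha\subseteq\beta+H$ for some $\beta\in G_0$, then there exist a nonempty subsequence $s_1\cdots s_r$ of $S$ and $w_1,\dots,w_r\in A$ such that $\sum_{i=1}^r w_is_i\in r\beta+H$.
   Context: Sequences are finite multisets; $|S|$ is the length. $A\cdot\alpha=\{a\alpha: a\in A\}$. For a finite abelian group $K$, $\mathsf D_A(K)$ is the least integer $\ell$ such that every sequence over $K$ of length $\ell$ has a nonempty subsequence $t_1\cdots t_r$ with $\sum_{i=1}^r a_it_i=0$ for some $a_i\in A$. -}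

module Defs where

open import Level using (Level; _⊔_)
open import Algebra.Bundles using (AbelianGroup)
open import Algebra.Bundles.Raw using (RawGroup)
open import Data.Nat using (ℕ; zero; suc; _≤_)
open import Data.Integer using (ℤ; +_; -[1+_])
open import Data.List using (List; []; _∷_; length; map)
open import Data.List.Relation.Unary.All using (All)
open import Data.List.Relation.Unary.Any using (Any)
open import Data.List.Relation.Binary.Sublist.Propositional using (_⊆_)
open import Data.Product using (Σ; ∃; _×_; _,_; proj₁; proj₂)
open import Relation.Nullary using (¬_)
open import Relation.Binary.PropositionalEquality using (_≡_)

module _ {c ℓ : Level} (K : RawGroup c ℓ) where
  open RawGroup K

  natMul : ℕ → Carrier → Carrier
  natMul zero    g = ε
  natMul (suc n) g = g ∙ natMul n g

  intMul : ℤ → Carrier → Carrier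
  intMul (+ n)    g = natMul n g
  intMul -[1+ n ] g = (natMul (suc n) g) ⁻¹

  gsum : List Carrier → Carrier
  gsum []       = ε
  gsum (x ∷ xs) = x ∙ gsum xs

  wsum : List (ℤ × Carrier) → Carrier
  wsum ps = gsum (map (λ p → intMul (proj₁ p) (proj₂ p)) ps)

  record WeightedSubseq {p : Level} (A : ℤ → Set p) (S : List Carrier) : Set (c ⊔ p) where
    field
      pairs    : List (ℤ × Carrier)
      nonempty : ¬ (pairs ≡ [])
      sub      : map proj₂ pairs ⊆ S
      inA      : All (λ q → A (proj₁ q)) pairs

  HasAZeroSum : {p : Level} (A : ℤ → Set p) → List Carrier → Set (c ⊔ ℓ ⊔ p)
  HasAZeroSum A S = Σ (WeightedSubseq A S) λ T → wsum (WeightedSubseq.pairs T) ≈ ε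

  record IsDavenportA {p : Level} (A : ℤ → Set p) (d : ℕ) : Set (c ⊔ ℓ ⊔ p) where
    field
      works : ∀ (S : List Carrier) → length S ≡ d → HasAZeroSum A S
      least : ∀ (m : ℕ) → (∀ (S : List Carrier) → length S ≡ m → HasAZeroSum A S) → d ≤ m

module _ {c ℓ : Level} (G₀ : AbelianGroup c ℓ) where
  open AbelianGroup G₀

  Finite : Set (c ⊔ ℓ)
  Finite = Σ (List Carrier) λ xs → ∀ x → Any (x ≈_) xs

  record IsSubgroup {p : Level} (P : Carrier → Set p) : Set (c ⊔ ℓ ⊔ p) where
    field
      resp  : ∀ {x y} → x ≈ y → P x → P y
      has-ε : P ε
      ∙-cl  : ∀ {x y} → P x → P y → P (x ∙ y)
      ⁻¹-cl : ∀ {x} → P x → P (x ⁻¹)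

  -- the quotient group G/H (H ≤ G), with carrier the elements of G and
  -- equality  x ≈ y  iff  x - y ∈ H  (setoid quotient)
  quotientGroup : {p : Level} (G H : Carrier → Set p) → IsSubgroup G → RawGroup (c ⊔ p) p
  quotientGroup G H sG = record
    { Carrier = Σ Carrier G
    ; _≈_     = λ x y → H (proj₁ x - proj₁ y)
    ; _∙_     = λ x y → (proj₁ x ∙ proj₁ y) , IsSubgroup.∙-cl sG (proj₂ x) (proj₂ y)
    ; ε       = ε , IsSubgroup.has-ε sG
    ; _⁻¹     = λ x → (proj₁ x ⁻¹) , IsSubgroup.⁻¹-cl sG (proj₂ x)
    }

module Submission where

-- Every term of S lies in α + G, so the shifted terms s - α
-- form a sequence over G/H.  Its first d = D_A(G/H) terms have a nonempty
-- A-weighted zero-sum subsequence in G/H, i.e. pairs (w_i , s_i) with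
-- w_i ∈ A, the s_i a subsequence of S and  Σ w_i (s_i - α) ∈ H.  Since
-- w_i α ∈ β + H for w_i ∈ A,
--     Σ w_i s_i - r β  =  Σ w_i (s_i - α)  +  Σ (w_i α - β)  ∈  H.

open import Defs
open import Level using (Level; _⊔_)
open import Algebra.Bundles.Raw using (RawGroup)
open import Algebra.Bundles using (AbelianGroup)
open import Data.Nat using (_≤_; zero; suc)
open import Data.Nat.Properties using (m≤n⇒m⊓n≡m)
open import Data.Integer using (ℤ; +_; -[1+_])
open import Data.List using (List; length; []; _∷_; map; take)
open import Data.List.Properties using (length-map; length-take; map-∘)
open import Data.List.Relation.Unary.All using (All; []; _∷_)
open import Data.List.Relation.Unary.All.Properties using () renaming (map⁺ to All-map⁺; map⁻ to All-map⁻)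
open import Data.List.Relation.Binary.Sublist.Propositional using (_⊆_; _∷_; _∷ʳ_; ⊆-trans; minimum)
open import Data.List.Relation.Binary.Sublist.Propositional.Properties using (map⁺; take-⊆)
open import Data.Product using (Σ; ∃; _×_; _,_; proj₁; proj₂; map₂)
open import Relation.Nullary using (¬_)
open import Relation.Binary.PropositionalEquality as ≡ using (_≡_; refl; cong; cong₂)
import Algebra.Properties.AbelianGroup as AbelianGroupProperties
import Algebra.Properties.CommutativeSemigroup as CommutativeSemigroupProperties
import Relation.Binary.Reasoning.Setoid as SetoidReasoning

pullback-⊆ : ∀ {a b w} {X : Set a} {Y : Set b} {W : Set w} (f : X → Y) (S : List X)
             (qs : List (W × Y)) → map proj₂ qs ⊆ map f S →
             Σ (List (W × X)) λ ps → map proj₂ ps ⊆ S × map (map₂ f) ps ≡ qs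
pullback-⊆ f S [] _ = [] , minimum S , refl
pullback-⊆ f (x ∷ S) (q ∷ qs) (.(f x) ∷ʳ σ) with pullback-⊆ f S (q ∷ qs) σ
... | ps , ps⊆S , eq = ps , x ∷ʳ ps⊆S , eq
pullback-⊆ f (x ∷ S) ((w , y) ∷ qs) (y≡fx ∷ σ) with pullback-⊆ f S qs σ
... | ps , ps⊆S , eq = (w , x) ∷ ps , refl ∷ ps⊆S , cong₂ _∷_ (cong (w ,_) (≡.sym y≡fx)) eq

proj₂-map₂ : ∀ {a b w} {X : Set a} {Y : Set b} {W : Set w} (f : X → Y) (ps : List (W × X)) →
             map proj₂ (map (map₂ f) ps) ≡ map f (map proj₂ ps)
proj₂-map₂ f ps = ≡.trans (≡.sym (map-∘ ps)) (map-∘ ps)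

nonempty-transfer : ∀ {a b} {X : Set a} {Y : Set b} (xs : List X) (ys : List Y) →
                    length xs ≡ length ys → ¬ (ys ≡ []) → ¬ (xs ≡ [])
nonempty-transfer [] []       _  ys≢[] _ = ys≢[] refl
nonempty-transfer [] (_ ∷ _)  () _     _
nonempty-transfer (_ ∷ _) _   _  _     ()

module AbelianGroupFacts {c ℓ : Level} (G₀ : AbelianGroup c ℓ) where
  open AbelianGroup G₀
  open AbelianGroupProperties G₀ using (⁻¹-∙-comm; ε⁻¹≈ε; ⁻¹-involutive)
  open CommutativeSemigroupProperties commutativeSemigroup using (interchange)
  open SetoidReasoning setoid

  natMul-∙ : ∀ n x y → natMul rawGroup n (x ∙ y) ≈ natMul rawGroup n x ∙ natMul rawGroup n y
  natMul-∙ zero    x y = sym (identityˡ ε)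
  natMul-∙ (suc n) x y = begin
    (x ∙ y) ∙ natMul rawGroup n (x ∙ y)
      ≈⟨ ∙-congˡ (natMul-∙ n x y) ⟩
    (x ∙ y) ∙ (natMul rawGroup n x ∙ natMul rawGroup n y)
      ≈⟨ interchange x y _ _ ⟩
    (x ∙ natMul rawGroup n x) ∙ (y ∙ natMul rawGroup n y) ∎

  natMul-⁻¹ : ∀ n x → natMul rawGroup n (x ⁻¹) ≈ natMul rawGroup n x ⁻¹
  natMul-⁻¹ zero    x = sym ε⁻¹≈ε
  natMul-⁻¹ (suc n) x = trans (∙-congˡ (natMul-⁻¹ n x)) (⁻¹-∙-comm x _)

  natMul-sub : ∀ n x y → natMul rawGroup n (x - y) ≈ natMul rawGroup n x - natMul rawGroup n y
  natMul-sub n x y = trans (natMul-∙ n x (y ⁻¹)) (∙-congˡ (natMul-⁻¹ n y))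

  intMul-sub : ∀ w x y → intMul rawGroup w (x - y) ≈ intMul rawGroup w x - intMul rawGroup w y
  intMul-sub (+ n)    x y = natMul-sub n x y
  intMul-sub -[1+ n ] x y = begin
    natMul rawGroup (suc n) (x - y) ⁻¹
      ≈⟨ ⁻¹-cong (natMul-sub (suc n) x y) ⟩
    (natMul rawGroup (suc n) x - natMul rawGroup (suc n) y) ⁻¹
      ≈⟨ sym (⁻¹-∙-comm _ _) ⟩
    natMul rawGroup (suc n) x ⁻¹ - natMul rawGroup (suc n) y ⁻¹ ∎

  sub-∙-interchange : ∀ x y u v → (x ∙ y) - (u ∙ v) ≈ (x - u) ∙ (y - v)
  sub-∙-interchange x y u v = begin
    (x ∙ y) ∙ (u ∙ v) ⁻¹      ≈⟨ ∙-congˡ (sym (⁻¹-∙-comm u v)) ⟩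
    (x ∙ y) ∙ (u ⁻¹ ∙ v ⁻¹)   ≈⟨ interchange x y _ _ ⟩
    (x - u) ∙ (y - v)         ∎

  sub-sub-cancel : ∀ x y z → (x - y) - (x - z) ≈ z - y
  sub-sub-cancel x y z = begin
    (x - y) - (x - z)           ≈⟨ sub-∙-interchange x (y ⁻¹) x (z ⁻¹) ⟩
    (x - x) ∙ (y ⁻¹ - z ⁻¹)     ≈⟨ ∙-congʳ (inverseʳ x) ⟩
    ε ∙ (y ⁻¹ - z ⁻¹)           ≈⟨ identityˡ _ ⟩
    y ⁻¹ ∙ z ⁻¹ ⁻¹              ≈⟨ ∙-congˡ (⁻¹-involutive z) ⟩
    y ⁻¹ ∙ z                    ≈⟨ comm _ _ ⟩
    z - y                       ∎

  sub-ε : ∀ x → x - ε ≈ x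
  sub-ε x = trans (∙-congˡ ε⁻¹≈ε) (identityʳ x)

  sub-∙-cancel : ∀ x y → (x - y) ∙ y ≈ x
  sub-∙-cancel x y = begin
    (x ∙ y ⁻¹) ∙ y   ≈⟨ assoc _ _ _ ⟩
    x ∙ (y ⁻¹ ∙ y)   ≈⟨ ∙-congˡ (inverseˡ y) ⟩
    x ∙ ε            ≈⟨ identityʳ x ⟩
    x                ∎

module SubgroupFacts {c ℓ p : Level} (G₀ : AbelianGroup c ℓ)
                     (H : AbelianGroup.Carrier G₀ → Set p) (sH : IsSubgroup G₀ H) where
  open AbelianGroup G₀
  open IsSubgroup sH
  open AbelianGroupFacts G₀
  open SetoidReasoning setoid

  H-from-diff : ∀ {x y} → H (x - y) → H y → H x
  H-from-diff {x} {y} x-y∈H y∈H = resp (sub-∙-cancel x y) (∙-cl x-y∈H y∈H)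

  shift-weights : (α β : Carrier) {a : Level} (A : ℤ → Set a) →
                  (∀ w → A w → H (intMul rawGroup w α - β)) →
                  (ps : List (ℤ × Carrier)) → All (λ q → A (proj₁ q)) ps →
                  H ((wsum rawGroup ps - natMul rawGroup (length ps) β)
                     - wsum rawGroup (map (map₂ (_- α)) ps))
  shift-weights α β A wα∈β+H [] [] = resp (sym ε-ε-ε≈ε) has-ε
    where
    ε-ε-ε≈ε : (ε - ε) - ε ≈ ε
    ε-ε-ε≈ε = trans (sub-ε (ε - ε)) (sub-ε ε)
  shift-weights α β A wα∈β+H ((w , s) ∷ ps) (w∈A ∷ ws∈A) =
    resp (sym rearrange) (∙-cl term∈H (shift-weights α β A wα∈β+H ps ws∈A))
    where
    W W' N ws : Carrier
    W  = wsum rawGroup ps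
    W' = wsum rawGroup (map (map₂ (_- α)) ps)
    N  = natMul rawGroup (length ps) β
    ws = intMul rawGroup w s

    term∈H : H ((ws - β) - intMul rawGroup w (s - α))
    term∈H = resp (sym (begin
      (ws - β) - intMul rawGroup w (s - α)
        ≈⟨ ∙-congˡ (⁻¹-cong (intMul-sub w s α)) ⟩
      (ws - β) - (ws - intMul rawGroup w α)
        ≈⟨ sub-sub-cancel ws β _ ⟩
      intMul rawGroup w α - β ∎)) (wα∈β+H w w∈A)

    rearrange : ((ws ∙ W) - (β ∙ N)) - (intMul rawGroup w (s - α) ∙ W')
                ≈ ((ws - β) - intMul rawGroup w (s - α)) ∙ ((W - N) - W')
    rearrange = begin
      ((ws ∙ W) - (β ∙ N)) - (intMul rawGroup w (s - α) ∙ W')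
        ≈⟨ ∙-congʳ (sub-∙-interchange ws W β N) ⟩
      ((ws - β) ∙ (W - N)) - (intMul rawGroup w (s - α) ∙ W')
        ≈⟨ sub-∙-interchange _ _ _ _ ⟩
      ((ws - β) - intMul rawGroup w (s - α)) ∙ ((W - N) - W') ∎

module ShiftedSequence {c ℓ p : Level} (G₀ : AbelianGroup c ℓ)
                       (G H : AbelianGroup.Carrier G₀ → Set p)
                       (sG : IsSubgroup G₀ G) (sH : IsSubgroup G₀ H)
                       (α : AbelianGroup.Carrier G₀) where
  open AbelianGroup G₀ using (Carrier; _∙_; _⁻¹; _-_; rawGroup)
  open AbelianGroupFacts G₀ using (sub-ε)

  G/H : RawGroup (c ⊔ p) p
  G/H = quotientGroup G₀ G H sG

  natMul-rep : ∀ n (t : Σ Carrier G) → proj₁ (natMul G/H n t) ≡ natMul rawGroup n (proj₁ t)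
  natMul-rep zero    t = refl
  natMul-rep (suc n) t = cong (proj₁ t ∙_) (natMul-rep n t)

  intMul-rep : ∀ w (t : Σ Carrier G) → proj₁ (intMul G/H w t) ≡ intMul rawGroup w (proj₁ t)
  intMul-rep (+ n)    t = natMul-rep n t
  intMul-rep -[1+ n ] t = cong _⁻¹ (natMul-rep (suc n) t)

  wsum-rep : ∀ (ps : List (ℤ × Σ Carrier G)) →
             proj₁ (wsum G/H ps) ≡ wsum rawGroup (map (map₂ proj₁) ps)
  wsum-rep []             = refl
  wsum-rep ((w , t) ∷ ps) = cong₂ _∙_ (intMul-rep w t) (wsum-rep ps)

  shift : (S : List Carrier) → All (λ s → G (s - α)) S → List (Σ Carrier G)
  shift []      []       = []
  shift (s ∷ S) (g ∷ gs) = (s - α , g) ∷ shift S gs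

  shift-rep : ∀ S gs → map proj₁ (shift S gs) ≡ map (_- α) S
  shift-rep []      []       = refl
  shift-rep (s ∷ S) (g ∷ gs) = cong (s - α ∷_) (shift-rep S gs)

  length-shift : ∀ S gs → length (shift S gs) ≡ length S
  length-shift []      []       = refl
  length-shift (s ∷ S) (g ∷ gs) = cong suc (length-shift S gs)

  lift-zero-sum : ∀ {a} {A : ℤ → Set a} (S : List Carrier) (gs : All (λ s → G (s - α)) S)
                  {T : List (Σ Carrier G)} → T ⊆ shift S gs → HasAZeroSum G/H A T →
                  Σ (WeightedSubseq rawGroup A S) λ U →
                    H (wsum rawGroup (map (map₂ (_- α)) (WeightedSubseq.pairs U)))
  lift-zero-sum {A = A} S gs T⊆shift (U' , zero-sum) = U , shifted-sum∈H
    where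
    open WeightedSubseq U' using ()
      renaming (pairs to ps'; nonempty to ps'≢[]; sub to ps'⊆T; inA to ps'∈A)

    qs : List (ℤ × Carrier)
    qs = map (map₂ proj₁) ps'

    qs⊆ : map proj₂ qs ⊆ map (_- α) S
    qs⊆ = ≡.subst₂ _⊆_ (≡.sym (proj₂-map₂ proj₁ ps')) (shift-rep S gs)
                       (map⁺ proj₁ (⊆-trans ps'⊆T T⊆shift))

    pulled : Σ (List (ℤ × Carrier)) λ ps → map proj₂ ps ⊆ S × map (map₂ (_- α)) ps ≡ qs
    pulled = pullback-⊆ (_- α) S qs qs⊆

    ps : List (ℤ × Carrier)
    ps = proj₁ pulled

    ps↦qs : map (map₂ (_- α)) ps ≡ qs
    ps↦qs = proj₂ (proj₂ pulled)

    length-ps : length ps ≡ length ps'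
    length-ps = ≡.trans (≡.sym (length-map (map₂ (_- α)) ps))
                        (≡.trans (cong length ps↦qs) (length-map (map₂ proj₁) ps'))

    -- reweighting by map₂ keeps the weights, so they stay in A
    ps∈A : All (λ q → A (proj₁ q)) ps
    ps∈A = All-map⁻ (≡.subst (All (λ q → A (proj₁ q))) (≡.sym ps↦qs) (All-map⁺ ps'∈A))

    U : WeightedSubseq rawGroup A S
    U = record { pairs    = ps
               ; nonempty = nonempty-transfer ps ps' length-ps ps'≢[]
               ; sub      = proj₁ (proj₂ pulled)
               ; inA      = ps∈A }

    shifted-sum∈H : H (wsum rawGroup (map (map₂ (_- α)) ps))
    shifted-sum∈H = ≡.subst (λ xs → H (wsum rawGroup xs)) (≡.sym ps↦qs)
                      (≡.subst H (wsum-rep ps') (IsSubgroup.resp sH (sub-ε _) zero-sum))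

-- Lemma 3.4.
lemma3p4 : {c ℓ p : Level} (G₀ : AbelianGroup c ℓ) →
    let open AbelianGroup G₀ in
    Finite G₀ →
    (G H : Carrier → Set p) → (sG : IsSubgroup G₀ G) → IsSubgroup G₀ H →
    (∀ x → H x → G x) →
    (α : Carrier) → (A : ℤ → Set p) → (∃ λ a → A a) →
    (S : List Carrier) → All (λ s → G (s - α)) S →
    (∃ λ d → IsDavenportA (quotientGroup G₀ G H sG) A d × d ≤ length S) →
    (β : Carrier) → (∀ a → A a → H (intMul rawGroup a α - β)) →
    Σ (WeightedSubseq rawGroup A S) λ T →
      H (wsum rawGroup (WeightedSubseq.pairs T)
         - natMul rawGroup (length (WeightedSubseq.pairs T)) β)
lemma3p4 G₀ _ G H sG sH _ α A _ S gs (d , D-isDavenport , d≤|S|) β wα∈β+H =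
  U , H-from-diff (shift-weights α β A wα∈β+H (WeightedSubseq.pairs U) (WeightedSubseq.inA U))
                  shifted-sum∈H
  where
  open AbelianGroup G₀ using (Carrier; rawGroup; _-_)
  open ShiftedSequence G₀ G H sG sH α
  open SubgroupFacts G₀ H sH

  prefix : List (Σ Carrier G)
  prefix = take d (shift S gs)

  length-prefix : length prefix ≡ d
  length-prefix = ≡.trans (length-take d (shift S gs))
                    (m≤n⇒m⊓n≡m (≡.subst (d ≤_) (≡.sym (length-shift S gs)) d≤|S|))

  lifted : Σ (WeightedSubseq rawGroup A S) λ U →
             H (wsum rawGroup (map (map₂ (_- α)) (WeightedSubseq.pairs U)))
  lifted = lift-zero-sum S gs (take-⊆ d (shift S gs))
             (IsDavenportA.works D-isDavenport prefix length-prefix)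

  U : WeightedSubseq rawGroup A S
  U = proj₁ lifted

  shifted-sum∈H : H (wsum rawGroup (map (map₂ (_- α)) (WeightedSubseq.pairs U)))
  shifted-sum∈H = proj₂ lifted
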